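{- Let $V$ be a vertex set with $|V|=n\ge 2$ and let $G$ be the disjoint union of $n-1$ spanning arborescences $A_1,\dots,A_{n-1}$ on $V$. Then for every integer $k$ with $1\le k\le \lfloor n/2\rfloor$, $G$ has a rainbow arborescence with exactly $k$ arcs.
   Context: An arborescence is a connected digraph in which exactly one vertex (the root) has no incoming arc and every other vertex has exactly one incoming arc; it is spanning on $V$ if its vertex set is $V$. $G$ is the disjoint union of the arc sets $A_i$ (parallel arcs of different indices allowed). A subgraph $B$ of $G$ is rainbow if $|B\cap A_i|\le 1$ for all $i$. The arborescence in the conclusion need not be spanning. -}

module Defs where

open import Data.Nat using (ℕ; _≤_)
open import Data.Fin using (Fin)
open import Data.Fin.Properties using (_≟_)
open import Data.Fin.Subset using (Subset; _∈_; ⊤)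
open import Data.Product using (_×_; _,_; proj₁; proj₂; Σ; ∃-syntax)
open import Data.List using (List; length; filter; map; lookup)
open import Data.List.Membership.Propositional renaming (_∈_ to _∈ₗ_)
open import Data.List.Relation.Unary.Unique.Propositional using (Unique)
open import Relation.Binary.PropositionalEquality using (_≡_)
open import Relation.Nullary using (¬_)

Arc : ℕ → Set
Arc n = Fin n × Fin n

tail head : ∀ {n} → Arc n → Fin n
tail = proj₁
head = proj₂

indeg : ∀ {n} → List (Arc n) → Fin n → ℕ
indeg B v = length (filter (λ e → head e ≟ v) B)

data Walk {n} (B : List (Arc n)) : Fin n → Fin n → Set where
  here : ∀ {u} → Walk B u u
  fwd  : ∀ {u w v} → (u , w) ∈ₗ B → Walk B w v → Walk B u v
  bwd  : ∀ {u w v} → (w , u) ∈ₗ B → Walk B w v → Walk B u v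

IsArborescenceOn : ∀ {n} → Subset n → List (Arc n) → Set
IsArborescenceOn {n} W B =
  ((e : Arc n) → e ∈ₗ B → (tail e ∈ W × head e ∈ W))
  × ((u v : Fin n) → u ∈ W → v ∈ W → Walk B u v)
  × (∃[ r ] (r ∈ W × indeg B r ≡ 0
             × ((v : Fin n) → v ∈ W → ¬ (v ≡ r) → indeg B v ≡ 1)))

IsArborescence : ∀ {n} → List (Arc n) → Set
IsArborescence {n} B = ∃[ W ] IsArborescenceOn {n} W B

IsSpanningArborescence : ∀ {n} → List (Arc n) → Set
IsSpanningArborescence B = IsArborescenceOn ⊤ B

-- The arc-coloured multigraph G = disjoint union of A i (i : Fin m).
-- An arc of G is identified by its colour i and its position in A i.
ArcId : ∀ {n m} → (Fin m → List (Arc n)) → Set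
ArcId {m = m} A = Σ (Fin m) (λ i → Fin (length (A i)))

arcOf : ∀ {n m} (A : Fin m → List (Arc n)) → ArcId A → Arc n
arcOf A (i , j) = lookup (A i) j

colour : ∀ {n m} {A : Fin m → List (Arc n)} → ArcId A → Fin m
colour = proj₁

IsRainbow : ∀ {n m} {A : Fin m → List (Arc n)} → List (ArcId A) → Set
IsRainbow {m = m} {A} B =
  (i : Fin m) → length (filter (λ a → colour {A = A} a ≟ i) B) ≤ 1

{-# OPTIONS --safe #-}
module Submission where

-- Rainbow arborescences with 0, 1, …, ⌊n/2⌋ arcs are grown one arc at a time.  Let T have j arcs
-- and vertex set W; since 2(j + 1) ≤ n, at least |W| = j + 1 of the n − 1 colours are unused.
-- If an unused colour c has its root in W, follow the c-parents from any vertex outside W to the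
-- last vertex z outside W: the c-arc into z extends T by a leaf.  Otherwise no unused colour has
-- its root in W, so every vertex of W has a parent in each unused colour, and contracting the root
-- of T gives a path from that root through distinct vertices of W, stepping to parents in distinct
-- unused colours, that finally leaves W at a vertex u.  The arcs of this path replace the tree
-- arcs into its vertices, which yields a rainbow arborescence rooted at u with vertex set W ∪ {u}.

open import Defs
open import Data.Nat using (ℕ; zero; suc; _+_; _∸_; _/_; _≤_; _<_; z≤n; s≤s)
open import Data.Nat.Properties
  using (≤-refl; ≤-trans; ≤-reflexive; ≤-antisym; ≤-pred; <-trans; <-irrefl; <⇒≱; 1+n≰n; n≤1+n;
         m≤n⇒m≤1+n; m≤n+m; m≤m+n; +-mono-≤; +-monoʳ-<; +-cancelˡ-≤; +-identityʳ; *-comm; module ≤-Reasoning)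
open import Data.Nat.DivMod using (m/n*n≤m)
open import Data.Nat.Induction using (<-wellFounded)
open import Data.Fin using (Fin; punchIn) renaming (zero to fzero)
open import Data.Fin.Properties using (_≟_; punchInᵢ≢i)
open import Data.Fin.Subset using (Subset; ⊤; ⁅_⁆; _∪_) renaming (_∈_ to _∈ₛ_; ⊥ to ∅)
open import Data.Fin.Subset.Properties using (∈⊤; ∉⊥; x∈⁅x⁆; x∈⁅y⁆⇒x≡y; x∈p∪q⁺; x∈p∪q⁻)
open import Data.Bool using (true; false)
open import Data.List using (List; []; _∷_; _++_; length; filter; map; lookup; allFin)
open import Data.List.Properties
  using (filter-notAll; filter-some; filter-none; length-tabulate; length-++; length-map; map-∘; map-id-local)
open import Data.List.Membership.Propositional using (_∈_; _∉_; lose; find)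
open import Data.List.Membership.Propositional.Properties
  using (∈-filter⁺; ∈-filter⁻; ∈-map⁺; ∈-map⁻; ∈-++⁺ˡ; ∈-++⁺ʳ; ∈-allFin)
open import Data.List.Relation.Binary.Subset.Propositional using (_⊆_)
open import Data.List.Relation.Unary.Any as Any using (Any; here; there; any?; satisfied)
open import Data.List.Relation.Unary.Any.Properties using (lookup-index)
open import Data.List.Relation.Unary.All as All using (All; []; _∷_)
open import Data.List.Relation.Unary.All.Properties as All using (¬Any⇒All¬)
open import Data.List.Relation.Unary.AllPairs as AllPairs using ([]; _∷_)
open import Data.List.Relation.Unary.Unique.Propositional using (Unique)
open import Data.List.Relation.Unary.Unique.Propositional.Properties as Unique using (allFin⁺; Unique[x∷xs]⇒x∉xs)
open import Data.Product using (Σ-syntax; ∃; ∃-syntax; _×_; _,_; proj₁; proj₂)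
open import Data.Sum using (_⊎_; inj₁; inj₂)
open import Data.Vec.Functional using (updateAt)
open import Data.Vec.Functional.Properties using (updateAt-updates; updateAt-minimal)
open import Function using (_∘_; id)
open import Induction.WellFounded using (Acc; acc)
open import Relation.Nullary using (Dec; yes; no; ¬?; does; contradiction)
open import Relation.Nullary.Decidable using (decidable-stable)
open import Relation.Unary using (Decidable)
open import Relation.Binary.Definitions using (DecidableEquality)
open import Relation.Binary.PropositionalEquality
  using (_≡_; _≢_; refl; sym; trans; cong; subst; subst₂; module ≡-Reasoning)

InjectiveOn : {A B : Set} → (A → B) → List A → Set
InjectiveOn f xs = ∀ {x y} → x ∈ xs → y ∈ xs → f x ≡ f y → x ≡ y

module _ {A : Set} where

  length-mono-⊆ : DecidableEquality A → {xs ys : List A} → Unique xs → xs ⊆ ys → length xs ≤ length ys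
  length-mono-⊆ _≟ᴬ_ {[]} _ _ = z≤n
  length-mono-⊆ _≟ᴬ_ {x ∷ xs} {ys} (x∉xs ∷ !xs) xs⊆ys = begin
    suc (length xs)                ≤⟨ s≤s (length-mono-⊆ _≟ᴬ_ !xs xs⊆ys-x) ⟩
    suc (length (filter ≢x? ys))   ≤⟨ filter-notAll ≢x? ys (Any.map (λ x≡y y≢x → y≢x (sym x≡y)) x∈ys) ⟩
    length ys                      ∎
    where
    open ≤-Reasoning
    x∈ys : x ∈ ys
    x∈ys = xs⊆ys (here refl)
    ≢x? : (y : A) → Dec (y ≢ x)
    ≢x? y = ¬? (y ≟ᴬ x)
    xs⊆ys-x : xs ⊆ filter ≢x? ys
    xs⊆ys-x y∈xs = ∈-filter⁺ ≢x? (xs⊆ys (there y∈xs)) (λ y≡x → All.lookup x∉xs y∈xs (sym y≡x))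

  Unique-map⇒injectiveOn : {B : Set} (f : A → B) {xs : List A} → Unique (map f xs) → InjectiveOn f xs
  Unique-map⇒injectiveOn f _ (here refl) (here refl) _ = refl
  Unique-map⇒injectiveOn f (fx∉ ∷ _) (here refl) (there y∈) fx≡fy =
    contradiction fx≡fy (All.lookup fx∉ (∈-map⁺ f y∈))
  Unique-map⇒injectiveOn f (fy∉ ∷ _) (there x∈) (here refl) fx≡fy =
    contradiction (sym fx≡fy) (All.lookup fy∉ (∈-map⁺ f x∈))
  Unique-map⇒injectiveOn f (_ ∷ !fxs) (there x∈) (there y∈) = Unique-map⇒injectiveOn f !fxs x∈ y∈

  injectiveOn⇒Unique-map : {B : Set} (f : A → B) {xs : List A} → Unique xs → InjectiveOn f xs → Unique (map f xs)
  injectiveOn⇒Unique-map f [] _ = []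
  injectiveOn⇒Unique-map f (x∉xs ∷ !xs) inj =
    All.map⁺ (All.tabulate λ y∈xs fx≡fy → All.lookup x∉xs y∈xs (inj (here refl) (there y∈xs) fx≡fy))
    ∷ injectiveOn⇒Unique-map f !xs (λ x∈ y∈ → inj (there x∈) (there y∈))

  length-filter-map : {B : Set} {P : B → Set} (P? : Decidable P) (f : A → B) (xs : List A) →
                      length (filter P? (map f xs)) ≡ length (filter (P? ∘ f) xs)
  length-filter-map P? f [] = refl
  length-filter-map P? f (x ∷ xs) with does (P? (f x))
  ... | true  = cong suc (length-filter-map P? f xs)
  ... | false = length-filter-map P? f xs

  module _ (_≟ᴬ_ : DecidableEquality A) where

    count : List A → A → ℕ
    count xs a = length (filter (_≟ᴬ a) xs)

    count-∉ : ∀ {xs a} → a ∉ xs → count xs a ≡ 0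
    count-∉ {xs} {a} a∉xs = cong length (filter-none (_≟ᴬ a) (All.map (_∘ sym) (¬Any⇒All¬ xs a∉xs)))

    count-Unique≤1 : ∀ {xs} → Unique xs → ∀ a → count xs a ≤ 1
    count-Unique≤1 [] a = z≤n
    count-Unique≤1 {x ∷ xs} (x∉xs ∷ !xs) a with x ≟ᴬ a
    ... | yes refl = s≤s (≤-reflexive (count-∉ λ a∈xs → All.lookup x∉xs a∈xs refl))
    ... | no _     = count-Unique≤1 !xs a

    count-Unique-∈ : ∀ {xs a} → Unique xs → a ∈ xs → count xs a ≡ 1
    count-Unique-∈ !xs a∈xs = ≤-antisym (count-Unique≤1 !xs _) (filter-some (_≟ᴬ _) (Any.map sym a∈xs))

module _ {n : ℕ} {B : List (Arc n)} where

  walk-++ : ∀ {u v w} → Walk B u v → Walk B v w → Walk B u w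
  walk-++ here        q = q
  walk-++ (fwd e p)   q = fwd e (walk-++ p q)
  walk-++ (bwd e p)   q = bwd e (walk-++ p q)

  walk-reverse : ∀ {u v} → Walk B u v → Walk B v u
  walk-reverse here      = here
  walk-reverse (fwd e p) = walk-++ (walk-reverse p) (bwd e here)
  walk-reverse (bwd e p) = walk-++ (walk-reverse p) (fwd e here)

-- At the root, arcInto is an arbitrary arc: only its values at other vertices are specified.
record ParentMap {n : ℕ} (B : List (Arc n)) : Set where
  field
    root          : Fin n
    arcInto       : Fin n → Fin (length B)
    head-arcInto  : ∀ {v} → v ≢ root → head (lookup B (arcInto v)) ≡ v
    depth         : Fin n → ℕ
    depth-parent< : ∀ {v} → v ≢ root → depth (tail (lookup B (arcInto v))) < depth v

  parent : Fin n → Fin n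
  parent v = tail (lookup B (arcInto v))

module SpanningArborescence {m : ℕ} {B : List (Arc (2 + m))} (r : Fin (2 + m))
  (connected   : (u v : Fin (2 + m)) → u ∈ₛ ⊤ → v ∈ₛ ⊤ → Walk B u v)
  (indeg-root  : indeg B r ≡ 0)
  (indeg-other : (v : Fin (2 + m)) → v ∈ₛ ⊤ → v ≢ r → indeg B v ≡ 1) where

  no-arc-into-root : ∀ {a} → (a , r) ∉ B
  no-arc-into-root ar∈B =
    1+n≰n (subst (1 ≤_) indeg-root (filter-some (λ e → head e ≟ r) (Any.map (λ { refl → refl }) ar∈B)))

  unique-arc-into : ∀ {v} → v ≢ r →
    Σ[ i ∈ Fin (length B) ] (head (lookup B i) ≡ v × (∀ {e} → e ∈ B → head e ≡ v → e ≡ lookup B i))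
  unique-arc-into {v} v≢r with filter (λ e → head e ≟ v) B in eq | indeg-other v ∈⊤ v≢r
  ... | e ∷ [] | _ = Any.index e∈B , subst (λ x → head x ≡ v) (lookup-index e∈B) head-e≡v , unique
    where
    e∈B×head-e≡v : e ∈ B × head e ≡ v
    e∈B×head-e≡v = ∈-filter⁻ (λ e → head e ≟ v) (subst (e ∈_) (sym eq) (here refl))
    e∈B : e ∈ B
    e∈B = proj₁ e∈B×head-e≡v
    head-e≡v : head e ≡ v
    head-e≡v = proj₂ e∈B×head-e≡v
    unique : ∀ {e′} → e′ ∈ B → head e′ ≡ v → e′ ≡ lookup B (Any.index e∈B)
    unique e′∈B refl with subst (_ ∈_) eq (∈-filter⁺ (λ e → head e ≟ v) e′∈B refl)
    ... | here e′≡e = trans e′≡e (lookup-index e∈B)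

  nonRoot : Fin (2 + m)
  nonRoot = punchIn r fzero

  nonRoot≢r : nonRoot ≢ r
  nonRoot≢r = punchInᵢ≢i r fzero

  arcInto : Fin (2 + m) → Fin (length B)
  arcInto v with v ≟ r
  ... | yes _  = proj₁ (unique-arc-into nonRoot≢r)
  ... | no v≢r = proj₁ (unique-arc-into v≢r)

  arcInto-spec : ∀ {v} (v≢r : v ≢ r) → arcInto v ≡ proj₁ (unique-arc-into v≢r)
  arcInto-spec {v} v≢r with v ≟ r
  ... | yes v≡r = contradiction v≡r v≢r
  ... | no _    = refl

  parent : Fin (2 + m) → Fin (2 + m)
  parent v = tail (lookup B (arcInto v))

  arc-into⇒parent : ∀ {a v} → (a , v) ∈ B → v ≢ r → a ≡ parent v
  arc-into⇒parent av∈B v≢r rewrite arcInto-spec v≢r = cong tail (proj₂ (proj₂ (unique-arc-into v≢r)) av∈B refl)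

  data ReachesRoot : Fin (2 + m) → Set where
    at-root    : ReachesRoot r
    via-parent : ∀ {v} → v ≢ r → ReachesRoot (parent v) → ReachesRoot v

  reaches-along-arc : ∀ {a b} → (a , b) ∈ B → ReachesRoot a → ReachesRoot b
  reaches-along-arc ab∈B ra = via-parent b≢r (subst ReachesRoot (arc-into⇒parent ab∈B b≢r) ra)
    where
    b≢r : _ ≢ r
    b≢r refl = no-arc-into-root ab∈B

  reaches-against-arc : ∀ {a b} → (a , b) ∈ B → ReachesRoot b → ReachesRoot a
  reaches-against-arc ab∈B at-root                = contradiction ab∈B no-arc-into-root
  reaches-against-arc ab∈B (via-parent b≢r rpb)   = subst ReachesRoot (sym (arc-into⇒parent ab∈B b≢r)) rpb

  reaches-along-walk : ∀ {u v} → Walk B u v → ReachesRoot u → ReachesRoot v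
  reaches-along-walk here        ru = ru
  reaches-along-walk (fwd e p)   ru = reaches-along-walk p (reaches-along-arc e ru)
  reaches-along-walk (bwd e p)   ru = reaches-along-walk p (reaches-against-arc e ru)

  reachesRoot : ∀ v → ReachesRoot v
  reachesRoot v = reaches-along-walk (connected r v ∈⊤ ∈⊤) at-root

  steps : ∀ {v} → ReachesRoot v → ℕ
  steps at-root            = 0
  steps (via-parent _ rp)  = suc (steps rp)

  steps-irrelevant : ∀ {v} (p q : ReachesRoot v) → steps p ≡ steps q
  steps-irrelevant at-root            at-root             = refl
  steps-irrelevant at-root            (via-parent r≢r _)  = contradiction refl r≢r
  steps-irrelevant (via-parent r≢r _) at-root             = contradiction refl r≢r
  steps-irrelevant (via-parent _ p)   (via-parent _ q)    = cong suc (steps-irrelevant p q)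

  depth : Fin (2 + m) → ℕ
  depth v = steps (reachesRoot v)

  parentMap : ParentMap B
  parentMap = record
    { root          = r
    ; arcInto       = arcInto
    ; head-arcInto  = λ v≢r → subst (λ i → head (lookup B i) ≡ _) (sym (arcInto-spec v≢r))
                                     (proj₁ (proj₂ (unique-arc-into v≢r)))
    ; depth         = depth
    ; depth-parent< = λ {v} v≢r →
        ≤-reflexive (steps-irrelevant (via-parent v≢r (reachesRoot (parent v))) (reachesRoot v))
    }

parentMap : ∀ {m} {B : List (Arc (2 + m))} → IsSpanningArborescence B → ParentMap B
parentMap (_ , connected , r , _ , indeg-root , indeg-other) =
  SpanningArborescence.parentMap r connected indeg-root indeg-other

module EscapePaths {V C : Set} (_≟ⱽ_ : DecidableEquality V) where

  open import Data.List.Membership.DecPropositional _≟ⱽ_ using (_∈?_)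

  data Escape (P : C → V → V) (W : List V) : V → List (V × C) → Set where
    exit : ∀ {v c}    → P c v ∉ W → Escape P W v ((v , c) ∷ [])
    step : ∀ {v c ps} → Escape P W (P c v) ps → Escape P W v ((v , c) ∷ ps)

  record RainbowEscape (P : C → V → V) (W : List V) (U : List C) (v : V) (ps : List (V × C)) : Set where
    field
      escape            : Escape P W v ps
      vertices⊆W        : All (λ s → proj₁ s ∈ W) ps
      colours⊆U         : All (λ s → proj₂ s ∈ U) ps
      distinct-vertices : Unique (map proj₁ ps)
      distinct-colours  : Unique (map proj₂ ps)

  open RainbowEscape

  ⊆-colours : ∀ {P W U U′ v ps} → U ⊆ U′ → RainbowEscape P W U v ps → RainbowEscape P W U′ v ps
  ⊆-colours U⊆U′ e = record
    { escape = escape e ; vertices⊆W = vertices⊆W e ; colours⊆U = All.map U⊆U′ (colours⊆U e)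
    ; distinct-vertices = distinct-vertices e ; distinct-colours = distinct-colours e }

  Descending : (C → V → V) → List V → List C → (C → V → ℕ) → Set
  Descending P W U δ = ∀ {c v} → c ∈ U → v ∈ W → P c v ∈ W → δ c (P c v) < δ c v

  Descending⇒parent≢ : ∀ {P W U δ c v} → Descending P W U δ → c ∈ U → v ∈ W → P c v ≢ v
  Descending⇒parent≢ {δ = δ} {c} desc c∈U v∈W Pcv≡v =
    <-irrefl (cong (δ c) Pcv≡v) (desc c∈U v∈W (subst (_∈ _) (sym Pcv≡v) v∈W))

  bypass : V → (V → V) → V → V
  bypass t f v with f v ≟ⱽ t
  ... | yes _ = f t
  ... | no _  = f v

  singleStep : ∀ {P W U v c} → v ∈ W → c ∈ U → P c v ∉ W → RainbowEscape P W U v ((v , c) ∷ [])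
  singleStep v∈W c∈U Pcv∉W = record
    { escape = exit Pcv∉W ; vertices⊆W = v∈W ∷ [] ; colours⊆U = c∈U ∷ []
    ; distinct-vertices = [] ∷ [] ; distinct-colours = [] ∷ [] }

  -- Remove the start t from W and let every parent map bypass t.  An escape of the
  -- contracted instance either avoids t, or its part after the last step into t,
  -- started at t, is an escape from t.
  module Contraction {P : C → V → V} {W : List V} {c : C} {U : List C} {δ : C → V → ℕ} {t : V}
    (t∈W : t ∈ W) (c∉U : All (c ≢_) U) (desc : Descending P W (c ∷ U) δ) where

    P′ : C → V → V
    P′ c′ = bypass t (P c′)

    ≢t? : (v : V) → Dec (v ≢ t)
    ≢t? v = ¬? (v ≟ⱽ t)

    W′ : List V
    W′ = filter ≢t? W

    W′⊆W : W′ ⊆ W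
    W′⊆W v∈W′ = proj₁ (∈-filter⁻ ≢t? {xs = W} v∈W′)

    W′∌t : ∀ {v} → v ∈ W′ → v ≢ t
    W′∌t v∈W′ = proj₂ (∈-filter⁻ ≢t? {xs = W} v∈W′)

    to-W′ : ∀ {v} → v ∈ W → v ≢ t → v ∈ W′
    to-W′ = ∈-filter⁺ ≢t?

    |W′|<|W| : length W′ < length W
    |W′|<|W| = filter-notAll ≢t? W (Any.map (λ t≡v v≢t → v≢t (sym t≡v)) t∈W)

    Pc′t≢t : ∀ {c′} → c′ ∈ c ∷ U → P c′ t ≢ t
    Pc′t≢t c′∈ = Descending⇒parent≢ desc c′∈ t∈W

    t∉W′-vertices : ∀ {ps : List (V × C)} → All (λ s → proj₁ s ∈ W′) ps → All (t ≢_) (map proj₁ ps)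
    t∉W′-vertices ps⊆W′ = All.map⁺ (All.map (λ s∈W′ t≡s → W′∌t s∈W′ (sym t≡s)) ps⊆W′)

    desc′ : Descending P′ W′ U δ
    desc′ {c′} {v} c′∈U v∈W′ P′c′v∈W′ with P c′ v ≟ⱽ t
    ... | yes hit = <-trans (desc (there c′∈U) t∈W (W′⊆W P′c′v∈W′))
                            (subst (λ x → δ c′ x < δ c′ v) hit
                                   (desc (there c′∈U) (W′⊆W v∈W′) (subst (_∈ W) (sym hit) t∈W)))
    ... | no _    = desc (there c′∈U) (W′⊆W v∈W′) (W′⊆W P′c′v∈W′)

    lift : ∀ {v ps} → RainbowEscape P′ W′ U v ps → Escape P W v ps ⊎ ∃ (RainbowEscape P W U t)
    lift {v} record { escape = exit {c = c′} P′c′v∉W′ ; colours⊆U = c′∈U ∷ [] } with P c′ v ≟ⱽ t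
    ... | yes _   = inj₂ (_ , singleStep t∈W c′∈U λ Pc′t∈W → P′c′v∉W′ (to-W′ Pc′t∈W (Pc′t≢t (there c′∈U))))
    ... | no miss = inj₁ (exit λ Pc′v∈W → P′c′v∉W′ (to-W′ Pc′v∈W miss))
    lift {v} {(_ , c′) ∷ ps} record
      { escape = step esc ; vertices⊆W = _ ∷ ps⊆W′ ; colours⊆U = c′∈U ∷ ps⊆U
      ; distinct-vertices = _ ∷ !vs ; distinct-colours = c′∉cs ∷ !cs }
      with lift record { escape = esc ; vertices⊆W = ps⊆W′ ; colours⊆U = ps⊆U
                       ; distinct-vertices = !vs ; distinct-colours = !cs }
    ... | inj₂ found = inj₂ found
    ... | inj₁ esc-P with P c′ v ≟ⱽ t
    ...   | yes _ = inj₂ (((t , c′) ∷ ps) , record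
      { escape = step esc-P
      ; vertices⊆W = t∈W ∷ All.map W′⊆W ps⊆W′ ; colours⊆U = c′∈U ∷ ps⊆U
      ; distinct-vertices = t∉W′-vertices ps⊆W′ ∷ !vs ; distinct-colours = c′∉cs ∷ !cs })
    ...   | no _ = inj₁ (step esc-P)

    combine : ∃ (RainbowEscape P′ W′ U (P c t)) → ∃ (RainbowEscape P W (c ∷ U) t)
    combine (ps , e) with lift e
    ... | inj₂ (qs , e′) = qs , ⊆-colours there e′
    ... | inj₁ esc-P = ((t , c) ∷ ps) , record
      { escape = step esc-P
      ; vertices⊆W = t∈W ∷ All.map W′⊆W (vertices⊆W e)
      ; colours⊆U = here refl ∷ All.map there (colours⊆U e)
      ; distinct-vertices = t∉W′-vertices (vertices⊆W e) ∷ distinct-vertices e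
      ; distinct-colours = All.map⁺ (All.map (All.lookup c∉U) (colours⊆U e)) ∷ distinct-colours e }

  rainbowEscape : ∀ P W U δ {t} → Unique U → length W ≤ length U → t ∈ W → Descending P W U δ →
                  ∃ (RainbowEscape P W U t)
  rainbowEscape P [] [] δ _ _ () _
  rainbowEscape P (_ ∷ _) [] δ _ () _ _
  rainbowEscape P W (c ∷ U) δ {t} (c∉U ∷ !U) |W|≤ t∈W desc with P c t ∈? W
  ... | no Pct∉W  = _ , singleStep t∈W (here refl) Pct∉W
  ... | yes Pct∈W =
    combine (rainbowEscape P′ W′ U δ !U (≤-pred (≤-trans |W′|<|W| |W|≤))
                           (to-W′ Pct∈W (Pc′t≢t (here refl))) desc′)
    where open Contraction t∈W c∉U desc

  stepsToExit : List (V × C) → V → ℕ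
  stepsToExit []             v = 0
  stepsToExit ((w , _) ∷ ps) v with v ≟ⱽ w
  ... | yes _ = length ps
  ... | no _  = stepsToExit ps v

  stepsToExit-start : ∀ {w c ps} → stepsToExit ((w , c) ∷ ps) w ≡ length ps
  stepsToExit-start {w} with w ≟ⱽ w
  ... | yes _   = refl
  ... | no w≢w  = contradiction refl w≢w

  stepsToExit-later : ∀ {v w c ps} → v ≢ w → stepsToExit ((w , c) ∷ ps) v ≡ stepsToExit ps v
  stepsToExit-later {v} {w} v≢w with v ≟ⱽ w
  ... | yes v≡w = contradiction v≡w v≢w
  ... | no _    = refl

  stepsToExit<length : ∀ ps {v} → v ∈ map proj₁ ps → stepsToExit ps v < length ps
  stepsToExit<length ((w , _) ∷ ps) {v} v∈ with v ≟ⱽ w | v∈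
  ... | yes _   | _         = ≤-refl
  ... | no v≢w  | here v≡w  = contradiction v≡w v≢w
  ... | no _    | there v∈ps = m≤n⇒m≤1+n (stepsToExit<length ps v∈ps)

  pathColour : List (V × C) → V → C → C
  pathColour []             v d = d
  pathColour ((w , c) ∷ ps) v d with v ≟ⱽ w
  ... | yes _ = c
  ... | no _  = pathColour ps v d

  pathColour-∈ : ∀ {ps v c d} → Unique (map proj₁ ps) → (v , c) ∈ ps → pathColour ps v d ≡ c
  pathColour-∈ {(w , _) ∷ ps} {v} (w∉ps ∷ !ps) vc∈ with v ≟ⱽ w | vc∈
  ... | yes _   | here refl  = refl
  ... | yes v≡w | there vc∈ps = contradiction (sym v≡w) (All.lookup w∉ps (∈-map⁺ proj₁ vc∈ps))
  ... | no v≢w  | here refl  = contradiction refl v≢w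
  ... | no _    | there vc∈ps = pathColour-∈ !ps vc∈ps

  pathColour-∉ : ∀ {ps v d} → v ∉ map proj₁ ps → pathColour ps v d ≡ d
  pathColour-∉ {[]} _ = refl
  pathColour-∉ {(w , _) ∷ ps} {v} v∉ with v ≟ⱽ w
  ... | yes v≡w = contradiction (here v≡w) v∉
  ... | no _    = pathColour-∉ (v∉ ∘ there)

  module _ {P : C → V → V} {W : List V} where

    exitVertex : ∀ {v ps} → Escape P W v ps → V
    exitVertex (exit {v} {c} _) = P c v
    exitVertex (step e)         = exitVertex e

    exitVertex∉W : ∀ {v ps} (e : Escape P W v ps) → exitVertex e ∉ W
    exitVertex∉W (exit Pcv∉W) = Pcv∉W
    exitVertex∉W (step e)     = exitVertex∉W e

    start∈ : ∀ {v ps} → Escape P W v ps → v ∈ map proj₁ ps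
    start∈ (exit _) = here refl
    start∈ (step _) = here refl

    parent-on-escape : ∀ {v ps w c} (e : Escape P W v ps) → (w , c) ∈ ps →
                       P c w ≡ exitVertex e ⊎ P c w ∈ map proj₁ ps
    parent-on-escape (exit _) (here refl) = inj₁ refl
    parent-on-escape (step e) (here refl) = inj₂ (there (start∈ e))
    parent-on-escape (step e) (there wc∈ps) with parent-on-escape e wc∈ps
    ... | inj₁ Pcw≡exit = inj₁ Pcw≡exit
    ... | inj₂ Pcw∈ps   = inj₂ (there Pcw∈ps)

    stepsToExit-parent< : ∀ {v ps w c} → Escape P W v ps → Unique (map proj₁ ps) → (w , c) ∈ ps → P c w ∈ W →
                          stepsToExit ps (P c w) < stepsToExit ps w
    stepsToExit-parent< (exit Pcv∉W) _ (here refl) Pcv∈W = contradiction Pcv∈W Pcv∉W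
    stepsToExit-parent< {v} {(_ , c) ∷ ps} (step e) (v∉ps ∷ _) (here refl) _ = begin-strict
      stepsToExit ((v , c) ∷ ps) (P c v) ≡⟨ stepsToExit-later {c = c} {ps} (All.lookup v∉ps (start∈ e) ∘ sym) ⟩
      stepsToExit ps (P c v)             <⟨ stepsToExit<length ps (start∈ e) ⟩
      length ps                          ≡⟨ stepsToExit-start {c = c} {ps} ⟨
      stepsToExit ((v , c) ∷ ps) v       ∎
      where open ≤-Reasoning
    stepsToExit-parent< {v} {(_ , c′) ∷ ps} {w} {c} (step e) (v∉ps ∷ !ps) (there wc∈ps) Pcw∈W
      with parent-on-escape e wc∈ps
    ... | inj₁ Pcw≡exit = contradiction (subst (_∈ W) Pcw≡exit Pcw∈W) (exitVertex∉W e)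
    ... | inj₂ Pcw∈ps   = begin-strict
      stepsToExit ((v , c′) ∷ ps) (P c w) ≡⟨ stepsToExit-later {c = c′} {ps} (All.lookup v∉ps Pcw∈ps ∘ sym) ⟩
      stepsToExit ps (P c w)              <⟨ stepsToExit-parent< e !ps wc∈ps Pcw∈W ⟩
      stepsToExit ps w                    ≡⟨ stepsToExit-later {c = c′} {ps} (All.lookup v∉ps (∈-map⁺ proj₁ wc∈ps) ∘ sym) ⟨
      stepsToExit ((v , c′) ∷ ps) w       ∎
      where open ≤-Reasoning

module RainbowGrowth {m : ℕ}
  (root          : Fin (1 + m) → Fin (2 + m))
  (parent        : Fin (1 + m) → Fin (2 + m) → Fin (2 + m))
  (depth         : Fin (1 + m) → Fin (2 + m) → ℕ)
  (depth-parent< : ∀ c {v} → v ≢ root c → depth c (parent c v) < depth c v) where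

  open import Data.List.Membership.DecPropositional (_≟_ {2 + m}) using (_∈?_)
  open import Data.List.Membership.DecPropositional (_≟_ {1 + m}) using () renaming (_∈?_ to _∈ᶜ?_)
  open EscapePaths {C = Fin (1 + m)} (_≟_ {2 + m})

  record RainbowTree (j : ℕ) : Set where
    field
      treeRoot         : Fin (2 + m)
      heads            : List (Fin (2 + m))
      length-heads     : length heads ≡ j
      unique-vertices  : Unique (treeRoot ∷ heads)
      arcColour        : Fin (2 + m) → Fin (1 + m)
      head≢root        : ∀ {v} → v ∈ heads → v ≢ root (arcColour v)
      parent∈          : ∀ {v} → v ∈ heads → parent (arcColour v) v ∈ treeRoot ∷ heads
      colour-injective : InjectiveOn arcColour heads
      height           : Fin (2 + m) → ℕ
      height-parent<   : ∀ {v} → v ∈ heads → height (parent (arcColour v) v) < height v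

  singleVertex : RainbowTree 0
  singleVertex = record
    { treeRoot = fzero ; heads = [] ; length-heads = refl ; unique-vertices = [] ∷ []
    ; arcColour = λ _ → fzero ; head≢root = λ () ; parent∈ = λ () ; colour-injective = λ ()
    ; height = λ _ → 0 ; height-parent< = λ () }

  last-outside : ∀ c {W : List (Fin (2 + m))} {z} → root c ∈ W → z ∉ W → ∃ λ z′ → z′ ∉ W × parent c z′ ∈ W
  last-outside c {W} {z} rc∈W z∉W = climb z z∉W (<-wellFounded (depth c z))
    where
    climb : ∀ z → z ∉ W → Acc _<_ (depth c z) → ∃ λ z′ → z′ ∉ W × parent c z′ ∈ W
    climb z z∉W (acc rs) with parent c z ∈? W
    ... | yes pz∈W = z , z∉W , pz∈W
    ... | no pz∉W  = climb (parent c z) pz∉W (rs (depth-parent< c λ z≡r → z∉W (subst (_∈ W) (sym z≡r) rc∈W)))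

  module Grow {j} (T : RainbowTree j) (room : suc j + suc j ≤ 2 + m) where
    open RainbowTree T

    W : List (Fin (2 + m))
    W = treeRoot ∷ heads

    length-W : length W ≡ suc j
    length-W = cong suc length-heads

    unused? : (c : Fin (1 + m)) → Dec (c ∉ map arcColour heads)
    unused? c = ¬? (c ∈ᶜ? map arcColour heads)

    U : List (Fin (1 + m))
    U = filter unused? (allFin (1 + m))

    unique-U : Unique U
    unique-U = Unique.filter⁺ unused? (allFin⁺ (1 + m))

    U∌arcColour : ∀ {v} → v ∈ heads → arcColour v ∉ U
    U∌arcColour v∈heads c∈U = proj₂ (∈-filter⁻ unused? {xs = allFin _} c∈U) (∈-map⁺ arcColour v∈heads)

    1+m≤j+|U| : 1 + m ≤ j + length U
    1+m≤j+|U| = begin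
      1 + m                                      ≡⟨ length-tabulate id ⟨
      length (allFin (1 + m))                    ≤⟨ length-mono-⊆ _≟_ (allFin⁺ (1 + m)) allFin⊆ ⟩
      length (map arcColour heads ++ U)          ≡⟨ length-++ (map arcColour heads) ⟩
      length (map arcColour heads) + length U    ≡⟨ cong (_+ length U) (trans (length-map arcColour heads) length-heads) ⟩
      j + length U                               ∎
      where
      open ≤-Reasoning
      allFin⊆ : allFin (1 + m) ⊆ map arcColour heads ++ U
      allFin⊆ {c} _ with c ∈ᶜ? map arcColour heads
      ... | yes used  = ∈-++⁺ˡ used
      ... | no unused = ∈-++⁺ʳ (map arcColour heads) (∈-filter⁺ unused? (∈-allFin c) unused)

    |W|≤|U| : length W ≤ length U
    |W|≤|U| = subst (_≤ length U) (sym length-W)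
                    (+-cancelˡ-≤ j (suc j) (length U) (≤-trans (≤-pred room) 1+m≤j+|U|))

    outside : ∃ (_∉ W)
    outside with any? (λ v → ¬? (v ∈? W)) (allFin (2 + m))
    ... | yes some = satisfied some
    ... | no none  =
      contradiction (subst₂ _≤_ (length-tabulate id) length-W (length-mono-⊆ _≟_ (allFin⁺ (2 + m)) allFin⊆W))
                    (<⇒≱ (≤-trans (s≤s (m≤n+m (suc j) j)) room))
      where
      allFin⊆W : allFin (2 + m) ⊆ W
      allFin⊆W {v} _ = decidable-stable (v ∈? W) λ v∉W → none (lose (∈-allFin v) v∉W)

    module AttachLeaf {c} (c∈U : c ∈ U) (rc∈W : root c ∈ W) where

      opaque
        leafWithParentIn : ∃ λ z → z ∉ W × parent c z ∈ W
        leafWithParentIn = last-outside c rc∈W (proj₂ outside)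

      leaf : Fin (2 + m)
      leaf = proj₁ leafWithParentIn

      leaf∉W : leaf ∉ W
      leaf∉W = proj₁ (proj₂ leafWithParentIn)

      parent-leaf∈W : parent c leaf ∈ W
      parent-leaf∈W = proj₂ (proj₂ leafWithParentIn)

      W∌leaf : ∀ {v} → v ∈ W → v ≢ leaf
      W∌leaf v∈W refl = leaf∉W v∈W

      arcColour′ : Fin (2 + m) → Fin (1 + m)
      arcColour′ = updateAt arcColour leaf (λ _ → c)

      height′ : Fin (2 + m) → ℕ
      height′ = updateAt height leaf (λ _ → suc (height (parent c leaf)))

      arcColour′-leaf : arcColour′ leaf ≡ c
      arcColour′-leaf = updateAt-updates leaf arcColour

      height′-leaf : height′ leaf ≡ suc (height (parent c leaf))
      height′-leaf = updateAt-updates leaf height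

      arcColour′-W : ∀ {v} → v ∈ W → arcColour′ v ≡ arcColour v
      arcColour′-W v∈W = updateAt-minimal _ leaf arcColour (W∌leaf v∈W)

      height′-W : ∀ {v} → v ∈ W → height′ v ≡ height v
      height′-W v∈W = updateAt-minimal _ leaf height (W∌leaf v∈W)

      W⊆W∪leaf : W ⊆ treeRoot ∷ leaf ∷ heads
      W⊆W∪leaf (here v≡r)     = here v≡r
      W⊆W∪leaf (there v∈heads) = there (there v∈heads)

      head≢root′ : ∀ {v} → v ∈ leaf ∷ heads → v ≢ root (arcColour′ v)
      head≢root′ (here refl) rewrite arcColour′-leaf = λ leaf≡rc → leaf∉W (subst (_∈ W) (sym leaf≡rc) rc∈W)
      head≢root′ (there v∈heads) rewrite arcColour′-W (there v∈heads) = head≢root v∈heads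

      parent∈′ : ∀ {v} → v ∈ leaf ∷ heads → parent (arcColour′ v) v ∈ treeRoot ∷ leaf ∷ heads
      parent∈′ (here refl) rewrite arcColour′-leaf = W⊆W∪leaf parent-leaf∈W
      parent∈′ (there v∈heads) rewrite arcColour′-W (there v∈heads) = W⊆W∪leaf (parent∈ v∈heads)

      arcColour′-injective : InjectiveOn arcColour′ (leaf ∷ heads)
      arcColour′-injective (here refl) (here refl) _ = refl
      arcColour′-injective (here refl) (there y∈heads) eq rewrite arcColour′-leaf | arcColour′-W (there y∈heads) =
        contradiction (subst (_∈ U) eq c∈U) (U∌arcColour y∈heads)
      arcColour′-injective (there x∈heads) (here refl) eq rewrite arcColour′-leaf | arcColour′-W (there x∈heads) =
        contradiction (subst (_∈ U) (sym eq) c∈U) (U∌arcColour x∈heads)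
      arcColour′-injective (there x∈heads) (there y∈heads) eq
        rewrite arcColour′-W (there x∈heads) | arcColour′-W (there y∈heads) = colour-injective x∈heads y∈heads eq

      height-parent<′ : ∀ {v} → v ∈ leaf ∷ heads → height′ (parent (arcColour′ v) v) < height′ v
      height-parent<′ (here refl) rewrite arcColour′-leaf | height′-W parent-leaf∈W | height′-leaf = ≤-refl
      height-parent<′ (there v∈heads)
        rewrite arcColour′-W (there v∈heads) | height′-W (parent∈ v∈heads) | height′-W (there v∈heads) =
        height-parent< v∈heads

      tree : RainbowTree (suc j)
      tree = record
        { treeRoot = treeRoot ; heads = leaf ∷ heads ; length-heads = cong suc length-heads
        ; unique-vertices = unique-vertices′ ; arcColour = arcColour′ ; head≢root = head≢root′
        ; parent∈ = parent∈′ ; colour-injective = arcColour′-injective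
        ; height = height′ ; height-parent< = height-parent<′ }
        where
        unique-vertices′ : Unique (treeRoot ∷ leaf ∷ heads)
        unique-vertices′ with unique-vertices
        ... | r∉heads ∷ !heads = (W∌leaf (here refl) ∷ r∉heads)
                               ∷ (All.tabulate (λ v∈heads leaf≡v → W∌leaf (there v∈heads) (sym leaf≡v)) ∷ !heads)

    module Reroot (roots-outside : ∀ {c} → c ∈ U → root c ∉ W) where

      descending : Descending parent W U depth
      descending {c} c∈U v∈W _ = depth-parent< c λ v≡rc → roots-outside c∈U (subst (_∈ W) v≡rc v∈W)

      opaque
        escapeFromRoot : ∃ (RainbowEscape parent W U treeRoot)
        escapeFromRoot = rainbowEscape parent W U depth unique-U |W|≤|U| (here refl) descending

      ps : List (Fin (2 + m) × Fin (1 + m))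
      ps = proj₁ escapeFromRoot

      open RainbowEscape (proj₂ escapeFromRoot)

      onPath : List (Fin (2 + m))
      onPath = map proj₁ ps

      onPath⊆W : onPath ⊆ W
      onPath⊆W v∈onPath with ∈-map⁻ proj₁ v∈onPath
      ... | _ , s∈ps , refl = All.lookup vertices⊆W s∈ps

      newRoot : Fin (2 + m)
      newRoot = exitVertex escape

      W∌newRoot : ∀ {v} → v ∈ W → v ≢ newRoot
      W∌newRoot v∈W refl = exitVertex∉W escape v∈W

      data Position (v : Fin (2 + m)) : Set where
        on-path  : ∀ c → (v , c) ∈ ps → Position v
        off-path : v ∉ onPath → v ∈ heads → Position v

      position : ∀ {v} → v ∈ W → Position v
      position {v} v∈W with v ∈? onPath
      ... | yes v∈onPath with ∈-map⁻ proj₁ v∈onPath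
      ...   | (_ , c) , vc∈ps , refl = on-path c vc∈ps
      position (here refl)     | no v∉onPath = contradiction (start∈ escape) v∉onPath
      position (there v∈heads) | no v∉onPath = off-path v∉onPath v∈heads

      arcColour′ : Fin (2 + m) → Fin (1 + m)
      arcColour′ v = pathColour ps v (arcColour v)

      arcColour′-on : ∀ {v c} → (v , c) ∈ ps → arcColour′ v ≡ c
      arcColour′-on = pathColour-∈ distinct-vertices

      arcColour′-off : ∀ {v} → v ∉ onPath → arcColour′ v ≡ arcColour v
      arcColour′-off = pathColour-∉

      offset : ℕ
      offset = suc (length ps)

      height′ : Fin (2 + m) → ℕ
      height′ v with v ∈? onPath | v ≟ newRoot
      ... | yes _ | _     = suc (stepsToExit ps v)
      ... | no _  | yes _ = 0
      ... | no _  | no _  = offset + height v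

      height′-on : ∀ {v} → v ∈ onPath → height′ v ≡ suc (stepsToExit ps v)
      height′-on {v} v∈onPath with v ∈? onPath
      ... | yes _        = refl
      ... | no v∉onPath  = contradiction v∈onPath v∉onPath

      height′-newRoot : height′ newRoot ≡ 0
      height′-newRoot with newRoot ∈? onPath | newRoot ≟ newRoot
      ... | yes newRoot∈onPath | _ = contradiction refl (W∌newRoot (onPath⊆W newRoot∈onPath))
      ... | no _ | yes _           = refl
      ... | no _ | no r≢r          = contradiction refl r≢r

      height′-off : ∀ {v} → v ∉ onPath → v ≢ newRoot → height′ v ≡ offset + height v
      height′-off {v} v∉onPath v≢newRoot with v ∈? onPath | v ≟ newRoot
      ... | yes v∈onPath | _ = contradiction v∈onPath v∉onPath
      ... | no _ | yes v≡newRoot = contradiction v≡newRoot v≢newRoot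
      ... | no _ | no _ = refl

      height′<offset+ : ∀ {v h} → v ∈ W → height v < h → height′ v < offset + h
      height′<offset+ {v} {h} v∈W hv<h with v ∈? onPath
      ... | yes v∈onPath = ≤-trans (s≤s (stepsToExit<length ps v∈onPath)) (m≤m+n offset h)
      ... | no _ with v ≟ newRoot
      ...   | yes v≡newRoot = contradiction v≡newRoot (W∌newRoot v∈W)
      ...   | no _          = +-monoʳ-< offset hv<h

      head≢root′ : ∀ {v} → v ∈ W → v ≢ root (arcColour′ v)
      head≢root′ v∈W with position v∈W
      ... | on-path c vc∈ps rewrite arcColour′-on vc∈ps =
        λ v≡rc → roots-outside (All.lookup colours⊆U vc∈ps) (subst (_∈ W) v≡rc v∈W)
      ... | off-path v∉onPath v∈heads rewrite arcColour′-off v∉onPath = head≢root v∈heads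

      parent∈′ : ∀ {v} → v ∈ W → parent (arcColour′ v) v ∈ newRoot ∷ W
      parent∈′ v∈W with position v∈W
      ... | on-path c vc∈ps rewrite arcColour′-on vc∈ps with parent-on-escape escape vc∈ps
      ...   | inj₁ p≡newRoot = here p≡newRoot
      ...   | inj₂ p∈onPath  = there (onPath⊆W p∈onPath)
      parent∈′ v∈W | off-path v∉onPath v∈heads rewrite arcColour′-off v∉onPath = there (parent∈ v∈heads)

      arcColour′-injective : InjectiveOn arcColour′ W
      arcColour′-injective x∈W y∈W eq with position x∈W | position y∈W
      ... | on-path _ xc∈ps | on-path _ yc∈ps rewrite arcColour′-on xc∈ps | arcColour′-on yc∈ps =
        cong proj₁ (Unique-map⇒injectiveOn proj₂ distinct-colours xc∈ps yc∈ps eq)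
      ... | on-path _ xc∈ps | off-path y∉onPath y∈heads rewrite arcColour′-on xc∈ps | arcColour′-off y∉onPath =
        contradiction (subst (_∈ U) eq (All.lookup colours⊆U xc∈ps)) (U∌arcColour y∈heads)
      ... | off-path x∉onPath x∈heads | on-path _ yc∈ps rewrite arcColour′-off x∉onPath | arcColour′-on yc∈ps =
        contradiction (subst (_∈ U) (sym eq) (All.lookup colours⊆U yc∈ps)) (U∌arcColour x∈heads)
      ... | off-path x∉onPath x∈heads | off-path y∉onPath y∈heads
        rewrite arcColour′-off x∉onPath | arcColour′-off y∉onPath = colour-injective x∈heads y∈heads eq

      height-parent<′ : ∀ {v} → v ∈ W → height′ (parent (arcColour′ v) v) < height′ v
      height-parent<′ v∈W with position v∈W
      ... | on-path c vc∈ps rewrite arcColour′-on vc∈ps | height′-on (∈-map⁺ proj₁ vc∈ps)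
        with parent-on-escape escape vc∈ps
      ...   | inj₁ p≡newRoot rewrite p≡newRoot | height′-newRoot = s≤s z≤n
      ...   | inj₂ p∈onPath  rewrite height′-on p∈onPath =
        s≤s (stepsToExit-parent< escape distinct-vertices vc∈ps (onPath⊆W p∈onPath))
      height-parent<′ {v} v∈W | off-path v∉onPath v∈heads
        rewrite arcColour′-off v∉onPath | height′-off v∉onPath (W∌newRoot v∈W) =
        height′<offset+ (parent∈ v∈heads) (height-parent< v∈heads)

      tree : RainbowTree (suc j)
      tree = record
        { treeRoot = newRoot ; heads = W ; length-heads = length-W
        ; unique-vertices = All.tabulate (λ v∈W newRoot≡v → W∌newRoot v∈W (sym newRoot≡v)) ∷ unique-vertices
        ; arcColour = arcColour′ ; head≢root = head≢root′ ; parent∈ = parent∈′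
        ; colour-injective = arcColour′-injective ; height = height′ ; height-parent< = height-parent<′ }

    grown : RainbowTree (suc j)
    grown with any? (λ c → root c ∈? W) U
    ... | yes some with (c , c∈U , rc∈W) ← find some = AttachLeaf.tree c∈U rc∈W
    ... | no none  = Reroot.tree λ c∈U rc∈W → none (lose c∈U rc∈W)

  rainbowTree : ∀ j → j + j ≤ 2 + m → RainbowTree j
  rainbowTree zero    _    = singleVertex
  rainbowTree (suc j) room = Grow.grown (rainbowTree j (≤-trans (+-mono-≤ (n≤1+n j) (n≤1+n j)) room)) room

toSubset : ∀ {n} → List (Fin n) → Subset n
toSubset []       = ∅
toSubset (x ∷ xs) = ⁅ x ⁆ ∪ toSubset xs

∈-toSubset⁺ : ∀ {n} {x : Fin n} {xs} → x ∈ xs → x ∈ₛ toSubset xs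
∈-toSubset⁺ (here refl)  = x∈p∪q⁺ (inj₁ (x∈⁅x⁆ _))
∈-toSubset⁺ (there x∈xs) = x∈p∪q⁺ (inj₂ (∈-toSubset⁺ x∈xs))

∈-toSubset⁻ : ∀ {n} {x : Fin n} xs → x ∈ₛ toSubset xs → x ∈ xs
∈-toSubset⁻ []       x∈∅ = contradiction x∈∅ ∉⊥
∈-toSubset⁻ (y ∷ ys) x∈  with x∈p∪q⁻ ⁅ y ⁆ (toSubset ys) x∈
... | inj₁ x∈⁅y⁆ = here (x∈⁅y⁆⇒x≡y y x∈⁅y⁆)
... | inj₂ x∈ys  = there (∈-toSubset⁻ ys x∈ys)

module RainbowArborescence {m : ℕ} (A : Fin (1 + m) → List (Arc (2 + m))) (pm : ∀ c → ParentMap (A c)) where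

  open RainbowGrowth (ParentMap.root ∘ pm) (ParentMap.parent ∘ pm) (ParentMap.depth ∘ pm)
                                     (ParentMap.depth-parent< ∘ pm) public
    using (RainbowTree; rainbowTree)

  module _ {k} (T : RainbowTree k) where
    open RainbowTree T

    arcId : Fin (2 + m) → ArcId A
    arcId v = arcColour v , ParentMap.arcInto (pm (arcColour v)) v

    ids : List (ArcId A)
    ids = map arcId heads

    arcs : List (Arc (2 + m))
    arcs = map (arcOf A) ids

    vertexSet : Subset (2 + m)
    vertexSet = toSubset (treeRoot ∷ heads)

    head-arcId : ∀ {v} → v ∈ heads → head (arcOf A (arcId v)) ≡ v
    head-arcId v∈heads = ParentMap.head-arcInto (pm _) (head≢root v∈heads)

    tree-arc∈ : ∀ {v} → v ∈ heads → (ParentMap.parent (pm (arcColour v)) v , v) ∈ arcs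
    tree-arc∈ {v} v∈heads = subst (λ x → (ParentMap.parent (pm (arcColour v)) v , x) ∈ arcs)
                                  (head-arcId v∈heads) (∈-map⁺ (arcOf A) (∈-map⁺ arcId v∈heads))

    unique-heads : Unique heads
    unique-heads = AllPairs.tail unique-vertices

    map-head-arcs : map head arcs ≡ heads
    map-head-arcs = begin
      map head (map (arcOf A) (map arcId heads)) ≡⟨ map-∘ (map arcId heads) ⟨
      map (head ∘ arcOf A) (map arcId heads)     ≡⟨ map-∘ heads ⟨
      map (head ∘ arcOf A ∘ arcId) heads         ≡⟨ map-id-local (All.tabulate head-arcId) ⟩
      heads                                      ∎
      where open ≡-Reasoning

    indeg-arcs : ∀ v → indeg arcs v ≡ count _≟_ heads v
    indeg-arcs v = trans (sym (length-filter-map (_≟ v) head arcs)) (cong (λ xs → count _≟_ xs v) map-head-arcs)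

    indeg-treeRoot : indeg arcs treeRoot ≡ 0
    indeg-treeRoot = trans (indeg-arcs treeRoot) (count-∉ _≟_ (Unique[x∷xs]⇒x∉xs unique-vertices))

    indeg-other : ∀ v → v ∈ₛ vertexSet → v ≢ treeRoot → indeg arcs v ≡ 1
    indeg-other v v∈ v≢r with ∈-toSubset⁻ (treeRoot ∷ heads) v∈
    ... | here v≡r      = contradiction v≡r v≢r
    ... | there v∈heads = trans (indeg-arcs v) (count-Unique-∈ _≟_ unique-heads v∈heads)

    walk-to-root : ∀ {v} → v ∈ treeRoot ∷ heads → Acc _<_ (height v) → Walk arcs v treeRoot
    walk-to-root (here refl)      _        = here
    walk-to-root (there v∈heads) (acc rs) =
      bwd (tree-arc∈ v∈heads) (walk-to-root (parent∈ v∈heads) (rs (height-parent< v∈heads)))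

    connected : ∀ u v → u ∈ₛ vertexSet → v ∈ₛ vertexSet → Walk arcs u v
    connected u v u∈ v∈ = walk-++ (walk-to-root (∈-toSubset⁻ _ u∈) (<-wellFounded _))
                                  (walk-reverse (walk-to-root (∈-toSubset⁻ _ v∈) (<-wellFounded _)))

    arcs-inside : ∀ e → e ∈ arcs → tail e ∈ₛ vertexSet × head e ∈ₛ vertexSet
    arcs-inside e e∈arcs with ∈-map⁻ (arcOf A) e∈arcs
    ... | a , a∈ids , refl with ∈-map⁻ arcId a∈ids
    ...   | v , v∈heads , refl =
      ∈-toSubset⁺ (parent∈ v∈heads) , ∈-toSubset⁺ (there (subst (_∈ heads) (sym (head-arcId v∈heads)) v∈heads))

    isArborescence : IsArborescence arcs
    isArborescence = vertexSet , arcs-inside , connected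
                   , treeRoot , ∈-toSubset⁺ {xs = treeRoot ∷ heads} (here refl) , indeg-treeRoot , indeg-other

    unique-ids : Unique ids
    unique-ids = injectiveOn⇒Unique-map arcId unique-heads λ x∈ y∈ eq →
      trans (sym (head-arcId x∈)) (trans (cong (head ∘ arcOf A) eq) (head-arcId y∈))

    rainbow : IsRainbow {A = A} ids
    rainbow i = subst (_≤ 1) count-colours≡ (count-Unique≤1 _≟_ unique-colours i)
      where
      unique-colours : Unique (map arcColour heads)
      unique-colours = injectiveOn⇒Unique-map arcColour unique-heads colour-injective
      count-colours≡ : count _≟_ (map arcColour heads) i ≡ length (filter (λ a → colour {A = A} a ≟ i) ids)
      count-colours≡ = trans (length-filter-map (_≟ i) arcColour heads)
                             (sym (length-filter-map (λ a → colour {A = A} a ≟ i) arcId heads))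

    rainbowArborescence : ∃[ B ] (Unique B × IsRainbow {A = A} B × length B ≡ k × IsArborescence (map (arcOf A) B))
    rainbowArborescence = ids , unique-ids , rainbow , trans (length-map arcId heads) length-heads , isArborescence

n/2+n/2≤n : ∀ n → n / 2 + n / 2 ≤ n
n/2+n/2≤n n = subst (_≤ n) (trans (*-comm (n / 2) 2) (cong (n / 2 +_) (+-identityʳ (n / 2)))) (m/n*n≤m n 2)

theorem4p3 : (n : ℕ) → 2 ≤ n →
    (A : Fin (n ∸ 1) → List (Arc n)) →
    ((i : Fin (n ∸ 1)) → IsSpanningArborescence (A i)) →
    (k : ℕ) → 1 ≤ k → k ≤ n / 2 →
    ∃[ B ] (Unique B × IsRainbow {A = A} B × length B ≡ k
            × IsArborescence (map (arcOf A) B))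
theorem4p3 (suc (suc m)) (s≤s (s≤s z≤n)) A spanning k _ k≤n/2 =
  rainbowArborescence (rainbowTree k (≤-trans (+-mono-≤ k≤n/2 k≤n/2) (n/2+n/2≤n (2 + m))))
  where open RainbowArborescence A (parentMap ∘ spanning)
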